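{- Let $k$ be a positive integer and let $D$ be a digraph with a partition $\{X,Y\}$ of $V(D)$ such that $D[X]$ is traceable and $Y$ is a stable set of $D$. Suppose $|X|\ge k$ and for every set $S\subseteq X$ with $|S|=k$ there is a vertex $y\in Y$ adjacent to every vertex of $S$. Let $P=(x_1,x_2,\ldots,x_\ell)$ be a Hamiltonian path of $D[X]$ that is zigzag-free in $D$. Then there exist (directed) paths $P_1$ and $P_2$ in $D$ such that: (i) $V(P_1)\cap V(P_2)=\varnothing$; (ii) $|P_1|+|P_2|=|X|+k+1$; (iii) the set of terminal vertices of $P_1$ and $P_2$ is $\{x_\ell,y\}$ for some $y\in Y$; (iv) $X\subseteq V(P_1)\cup V(P_2)$.
   Context: Digraphs have no loops and no parallel arcs (directed 2-cycles allowed). The size $|P|$ of a path is its number of vertices; the terminal vertex of a path is its last vertex. Two vertices $u,v$ are adjacent if $(u,v)\in A(D)$ or $(v,u)\in A(D)$; a stable set is a set of pairwise non-adjacent vertices. A Hamiltonian path $P=(x_1,\ldots,x_\ell)$ of $D[X]$ is zigzag-free in $D$ if there is no vertex $y\in Y$ such that $(y,x_1)\in A(D)$, or $(x_\ell,y)\in A(D)$, or $(x_i,y)\in A(D)$ and $(y,x_{i+1})\in A(D)$ for some $1\le i<\ell$. -}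

module Defs where

open import Data.Nat using (ℕ; _+_; _≥_)
open import Data.Fin using (Fin)
open import Data.Fin.Subset using (Subset; ∣_∣; _⊆_) renaming (_∈_ to _∈ₛ_; _∉_ to _∉ₛ_)
open import Data.List using (List; []; _∷_; _++_; [_]; length; last)
open import Data.List.Membership.Propositional using (_∈_; _∉_)
open import Data.List.Relation.Unary.Unique.Propositional using (Unique)
open import Data.Maybe using (Maybe; just)
open import Data.Product using (Σ; ∃; ∃-syntax; _×_)
open import Data.Sum using (_⊎_)
open import Relation.Nullary using (¬_)
open import Relation.Binary.PropositionalEquality using (_≡_)
open import Level using (0ℓ) renaming (suc to lsuc)

-- A digraph on vertex set Fin n: an arc relation without loops.
-- (As a relation, there are no parallel arcs; directed 2-cycles are allowed.)
record Digraph : Set₁ where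
  field
    n     : ℕ
    Arc   : Fin n → Fin n → Set
    noLoop : ∀ v → ¬ Arc v v

open Digraph public

module _ (D : Digraph) where

  Vtx : Set
  Vtx = Fin (n D)

  Adj : Vtx → Vtx → Set
  Adj u v = Arc D u v ⊎ Arc D v u

  data Linked : List Vtx → Set where
    []  : Linked []
    [-] : ∀ {x} → Linked (x ∷ [])
    _∷_ : ∀ {x y zs} → Arc D x y → Linked (y ∷ zs) → Linked (x ∷ y ∷ zs)

  -- a directed path, given by its list of vertices (size = length)
  IsPath : List Vtx → Set
  IsPath ps = Unique ps × Linked ps

  StableCompl : Subset (n D) → Set
  StableCompl X = ∀ u v → u ∉ₛ X → v ∉ₛ X → ¬ Adj u v

  HamPathOf : Subset (n D) → List Vtx → Set
  HamPathOf X ps = IsPath ps × (∀ v → v ∈ ps → v ∈ₛ X) × (∀ v → v ∈ₛ X → v ∈ ps)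

  Traceable : Subset (n D) → Set
  Traceable X = ∃[ ps ] HamPathOf X ps

  ZigzagFree : Subset (n D) → List Vtx → Set
  ZigzagFree X ps = ∀ y → y ∉ₛ X →
      (∀ x bs → ps ≡ x ∷ bs → ¬ Arc D y x)
    × (∀ as x → ps ≡ as ++ [ x ] → ¬ Arc D x y)
    × (∀ as x x' bs → ps ≡ as ++ x ∷ x' ∷ bs → ¬ (Arc D x y × Arc D y x'))

-- Induction on k, scanning along the zigzag-free path x₁ … x_ℓ. A common
-- Y-neighbour of x₁, …, x_{k+1} receives an arc from each of them: the first
-- arc must enter it, and an arc entering it is never followed by one leaving it.
-- At a position i with an arc xᵢ → yᵢ ∈ Y, apply the induction hypothesis for k
-- to x₁ … xᵢ, with Y replaced by the in-neighbours of x_{i+1} in Y: adding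
-- x_{i+1} to a k-subset gives a common neighbour, which either sends an arc to
-- x_{i+1} or receives one from it. In the first case the two paths obtained,
-- Q₁ ending at xᵢ and Q₂ ending at some y → x_{i+1}, become Q₂ x_{i+1} … x_ℓ and
-- Q₁ yᵢ; in the second case the scan moves on to x_{i+1}. It ends before x_ℓ,
-- which has no arc into Y.
module Submission where

open import Defs
open import Data.Nat using (ℕ; _+_; _≥_; _>_)
open import Data.Fin.Subset using (Subset; ∣_∣; _⊆_) renaming (_∈_ to _∈ₛ_; _∉_ to _∉ₛ_)
open import Data.List using (List; _∷_; _++_; [_]; length; last)
open import Data.List.Membership.Propositional using (_∈_; _∉_)
open import Data.Maybe using (just)
open import Data.Product using (Σ; ∃; ∃-syntax; _×_)
open import Data.Sum using (_⊎_)
open import Relation.Nullary using (¬_)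
open import Relation.Binary.PropositionalEquality using (_≡_)

open import Level using (0ℓ)
open import Data.Empty using (⊥; ⊥-elim)
open import Data.Nat using (zero; suc; _≤_; _<_; s≤s)
open import Data.Nat.Properties using (≤-refl; ≤-trans; ≤-reflexive; m≤m+n; +-identityʳ; +-comm)
open import Data.Nat.Tactic.RingSolver using (solve-∀)
open import Data.Fin using (Fin) renaming (zero to fzero; suc to fsuc)
open import Data.Fin.Subset using (inside; outside; ⁅_⁆; _∪_; ⋃)
open import Data.Fin.Subset.Properties
  using (∉⊥; x∈⁅x⁆; x∈⁅y⁆⇒x≡y; x∈p∪q⁺; x∈p∪q⁻; ∪-identityˡ; ∣⊥∣≡0; ⊆-antisym)
open import Data.Vec using (_∷_; here; there)
open import Data.List using (_∷ʳ_; map; [])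
open import Data.List.Properties using (length-++; ++-assoc; ∷ʳ-++; ∷ʳ-injectiveʳ)
open import Data.List.Membership.Propositional.Properties using (∈-++⁺ˡ; ∈-++⁺ʳ; ∈-++⁻)
open import Data.List.Relation.Binary.Disjoint.Propositional using (Disjoint)
open import Data.List.Relation.Unary.Any using (here; there)
open import Data.List.Relation.Unary.All as All using (All; []; _∷_)
open import Data.List.Relation.Unary.All.Properties using (∷ʳ⁻; ++⁻ˡ; ++⁻ʳ)
open import Data.List.Relation.Unary.AllPairs using ([]; _∷_)
open import Data.List.Relation.Unary.Unique.Propositional using (Unique)
import Data.List.Relation.Unary.Unique.Propositional.Properties as Unique
open import Data.Product using (_,_; proj₁; proj₂)
open import Data.Sum using (inj₁; inj₂; [_,_]′; swap; fromInj₁) renaming (map to ⊎-map)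
open import Function using (_∘_)
open import Relation.Binary.PropositionalEquality using (_≢_; refl; sym; trans; cong; cong₂; subst; module ≡-Reasoning)
open import Relation.Unary using (Pred; _∩_)

fromList : ∀ {n} → List (Fin n) → Subset n
fromList xs = ⋃ (map ⁅_⁆ xs)

∈-fromList⁺ : ∀ {n} {v : Fin n} {xs} → v ∈ xs → v ∈ₛ fromList xs
∈-fromList⁺ {v = v} (here refl) = x∈p∪q⁺ (inj₁ (x∈⁅x⁆ v))
∈-fromList⁺ (there v∈xs)        = x∈p∪q⁺ (inj₂ (∈-fromList⁺ v∈xs))

∈-fromList⁻ : ∀ {n} {v : Fin n} xs → v ∈ₛ fromList xs → v ∈ xs
∈-fromList⁻ []       v∈⊥ = ⊥-elim (∉⊥ v∈⊥)
∈-fromList⁻ (x ∷ xs) v∈  with x∈p∪q⁻ ⁅ x ⁆ (fromList xs) v∈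
... | inj₁ v∈⁅x⁆ = here (x∈⁅y⁆⇒x≡y x v∈⁅x⁆)
... | inj₂ v∈xs  = there (∈-fromList⁻ xs v∈xs)

∣⁅x⁆∪p∣≡1+∣p∣ : ∀ {n} (x : Fin n) (p : Subset n) → x ∉ₛ p → ∣ ⁅ x ⁆ ∪ p ∣ ≡ suc ∣ p ∣
∣⁅x⁆∪p∣≡1+∣p∣ fzero    (inside  ∷ p) x∉p = ⊥-elim (x∉p here)
∣⁅x⁆∪p∣≡1+∣p∣ fzero    (outside ∷ p) _   = cong (λ q → suc ∣ q ∣) (∪-identityˡ p)
∣⁅x⁆∪p∣≡1+∣p∣ (fsuc x) (inside  ∷ p) x∉p = cong suc (∣⁅x⁆∪p∣≡1+∣p∣ x p (λ x∈p → x∉p (there x∈p)))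
∣⁅x⁆∪p∣≡1+∣p∣ (fsuc x) (outside ∷ p) x∉p = ∣⁅x⁆∪p∣≡1+∣p∣ x p (λ x∈p → x∉p (there x∈p))

∣fromList∣≡length : ∀ {n} {xs : List (Fin n)} → Unique xs → ∣ fromList xs ∣ ≡ length xs
∣fromList∣≡length {n} {[]}      []           = ∣⊥∣≡0 n
∣fromList∣≡length {xs = x ∷ xs} (x∉xs ∷ xs!) = trans
  (∣⁅x⁆∪p∣≡1+∣p∣ x (fromList xs) (λ x∈ → All.lookup x∉xs (∈-fromList⁻ xs x∈) refl))
  (cong suc (∣fromList∣≡length xs!))

∣p∣≡length : ∀ {n} {p : Subset n} {xs} → Unique xs →
             (∀ {v} → v ∈ₛ p → v ∈ xs) → (∀ {v} → v ∈ xs → v ∈ₛ p) → ∣ p ∣ ≡ length xs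
∣p∣≡length {xs = xs} xs! p⊆xs xs⊆p = trans
  (cong ∣_∣ (⊆-antisym (λ v∈p → ∈-fromList⁺ (p⊆xs v∈p)) (λ v∈ → xs⊆p (∈-fromList⁻ xs v∈))))
  (∣fromList∣≡length xs!)

size-extend : ∀ q₁ q₂ p m k → q₁ + q₂ ≡ p + k + 1 → (q₂ + m) + (q₁ + 1) ≡ (p + m) + suc k + 1
size-extend q₁ q₂ p m k q₁+q₂≡ = begin
  (q₂ + m) + (q₁ + 1)  ≡⟨ regroup q₁ q₂ m ⟩
  (q₁ + q₂) + m + 1    ≡⟨ cong (λ q → q + m + 1) q₁+q₂≡ ⟩
  (p + k + 1) + m + 1  ≡⟨ regroup′ p k m ⟩
  (p + m) + suc k + 1  ∎
  where
  open ≡-Reasoning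
  regroup : ∀ q₁ q₂ m → (q₂ + m) + (q₁ + 1) ≡ (q₁ + q₂) + m + 1
  regroup = solve-∀
  regroup′ : ∀ p k m → (p + k + 1) + m + 1 ≡ (p + m) + suc k + 1
  regroup′ = solve-∀

module _ {A : Set} where

  last-++-∷ : ∀ (xs : List A) y ys → last (xs ++ y ∷ ys) ≡ last (y ∷ ys)
  last-++-∷ []            y ys = refl
  last-++-∷ (x ∷ [])      y ys = refl
  last-++-∷ (x ∷ x′ ∷ xs) y ys = last-++-∷ (x′ ∷ xs) y ys

  Unique-++⁻ : ∀ (xs : List A) {ys} → Unique (xs ++ ys) → Unique xs × Unique ys × Disjoint xs ys
  Unique-++⁻ []       ys!          = [] , ys! , λ ()
  Unique-++⁻ (x ∷ xs) (x∉ ∷ xsys!) with Unique-++⁻ xs xsys!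
  ... | xs! , ys! , xs#ys = ++⁻ˡ xs x∉ ∷ xs! , ys! , λ
    { (here refl , v∈ys) → All.lookup (++⁻ʳ xs x∉) v∈ys refl
    ; (there v∈xs , v∈ys) → xs#ys (v∈xs , v∈ys) }

  length-≤-∷ʳ : ∀ (xs : List A) x → length xs ≤ length (xs ∷ʳ x)
  length-≤-∷ʳ xs x = ≤-trans (m≤m+n (length xs) 1) (≤-reflexive (sym (length-++ xs)))

  ∃-split-at : ∀ k (xs : List A) → k < length xs →
               ∃[ as ] ∃[ a ] ∃[ bs ] (xs ≡ as ++ a ∷ bs × length as ≡ k)
  ∃-split-at zero    (x ∷ xs) _       = [] , x , xs , refl , refl
  ∃-split-at (suc k) (x ∷ xs) (s≤s k<) with ∃-split-at k xs k<
  ... | as , a , bs , refl , refl = x ∷ as , a , bs , refl , refl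

module _ (D : Digraph) where

  private
    V : Set
    V = Vtx D

  Linked-++⁻ˡ : ∀ xs {ys} → Linked D (xs ++ ys) → Linked D xs
  Linked-++⁻ˡ []            _         = []
  Linked-++⁻ˡ (x ∷ [])      _         = [-]
  Linked-++⁻ˡ (x ∷ x′ ∷ xs) (xx′ ∷ l) = xx′ ∷ Linked-++⁻ˡ (x′ ∷ xs) l

  Linked-++⁻ʳ : ∀ xs {ys} → Linked D (xs ++ ys) → Linked D ys
  Linked-++⁻ʳ []            l               = l
  Linked-++⁻ʳ (x ∷ [])      {[]}    _       = []
  Linked-++⁻ʳ (x ∷ [])      {_ ∷ _} (_ ∷ l) = l
  Linked-++⁻ʳ (x ∷ x′ ∷ xs) (_ ∷ l)         = Linked-++⁻ʳ (x′ ∷ xs) l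

  Linked-join : ∀ xs {x y ys} → Linked D xs → last xs ≡ just x → Arc D x y →
                Linked D (y ∷ ys) → Linked D (xs ++ y ∷ ys)
  Linked-join (x ∷ [])      [-]       refl xy l′ = xy ∷ l′
  Linked-join (x ∷ x′ ∷ xs) (xx′ ∷ l) e    xy l′ = xx′ ∷ Linked-join (x′ ∷ xs) l e xy l′

  IsPath-++⁻ : ∀ xs {ys} → IsPath D (xs ++ ys) → IsPath D xs × IsPath D ys × Disjoint xs ys
  IsPath-++⁻ xs (xsys! , l) with Unique-++⁻ xs xsys!
  ... | xs! , ys! , xs#ys = (xs! , Linked-++⁻ˡ xs l) , (ys! , Linked-++⁻ʳ xs l) , xs#ys

  IsPath-join : ∀ xs {x y ys} → IsPath D xs → IsPath D (y ∷ ys) → Disjoint xs (y ∷ ys) →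
                last xs ≡ just x → Arc D x y → IsPath D (xs ++ y ∷ ys)
  IsPath-join xs (xs! , l) (ys! , l′) xs#ys e xy =
    Unique.++⁺ xs! ys! xs#ys , Linked-join xs l e xy l′

  NoArcToHead : V → List V → Set
  NoArcToHead y ps = ∀ x bs → ps ≡ x ∷ bs → ¬ Arc D y x

  NoArcFromLast : V → List V → Set
  NoArcFromLast y ps = ∀ as x → ps ≡ as ++ [ x ] → ¬ Arc D x y

  NoZigzag : V → List V → Set
  NoZigzag y ps = ∀ as x x′ bs → ps ≡ as ++ x ∷ x′ ∷ bs → ¬ (Arc D x y × Arc D y x′)

  NoArcToHead-++⁻ˡ : ∀ {y} xs {ys} → NoArcToHead y (xs ++ ys) → NoArcToHead y xs
  NoArcToHead-++⁻ˡ _ {ys} h x bs refl = h x (bs ++ ys) refl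

  NoZigzag-++⁻ˡ : ∀ {y} xs {ys} → NoZigzag y (xs ++ ys) → NoZigzag y xs
  NoZigzag-++⁻ˡ _ {ys} h as x x′ bs refl = h as x x′ (bs ++ ys) (++-assoc as (x ∷ x′ ∷ bs) ys)

  adjacent⇒arcsInto : ∀ {y} xs → NoArcToHead y xs → NoZigzag y xs →
                      All (Adj D y) xs → All (λ x → Arc D x y) xs
  adjacent⇒arcsInto []       _    _  []              = []
  adjacent⇒arcsInto (x ∷ xs) head _  (inj₁ yx ∷ _)   = ⊥-elim (head x xs refl yx)
  adjacent⇒arcsInto (x ∷ xs) _    zz (inj₂ xy ∷ adj) = xy ∷ adjacent⇒arcsInto xs head′ zz′ adj
    where
    head′ : NoArcToHead _ xs
    head′ x′ bs refl yx′ = zz [] x x′ bs refl (xy , yx′)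
    zz′ : NoZigzag _ xs
    zz′ as z z′ bs e = zz (x ∷ as) z z′ bs (cong (x ∷_) e)

  InNeighbourOf : V → Pred V 0ℓ
  InNeighbourOf b v = Arc D v b

  OutNeighbourIn : Pred V 0ℓ → V → Set
  OutNeighbourIn Y b = ∃[ z ] (Y z × Arc D b z)

  record ZigzagFreePath (Y : Pred V 0ℓ) (ps : List V) : Set where
    field
      isPath        : IsPath D ps
      avoids        : ∀ {y} → Y y → y ∉ ps
      noArcToHead   : ∀ {y} → Y y → NoArcToHead y ps
      noArcFromLast : ∀ {y} → Y y → NoArcFromLast y ps
      noZigzag      : ∀ {y} → Y y → NoZigzag y ps

  CommonNeighbour : Pred V 0ℓ → List V → Set
  CommonNeighbour Y ss = ∃[ y ] (Y y × All (Adj D y) ss)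

  -- The escape E makes the hypothesis usable in the recursion, where for
  -- some k-set it may fail and instead yield an arc leaving the path into Y.
  CommonNeighboursOr : ℕ → Pred V 0ℓ → List V → Set → Set
  CommonNeighboursOr k Y ps E =
    ∀ ss → Unique ss → length ss ≡ k → All (_∈ ps) ss → CommonNeighbour Y ss ⊎ E

  record TwoPaths (k : ℕ) (Y : Pred V 0ℓ) (ps : List V) : Set where
    field
      P₁ P₂    : List V
      isPath₁  : IsPath D P₁
      isPath₂  : IsPath D P₂
      disjoint : Disjoint P₁ P₂
      size     : length P₁ + length P₂ ≡ length ps + k + 1
      last₁    : last P₁ ≡ last ps
      end      : V
      end∈Y    : Y end
      last₂    : last P₂ ≡ just end
      ⊆₁       : ∀ {v} → v ∈ P₁ → v ∈ ps ⊎ Y v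
      ⊆₂       : ∀ {v} → v ∈ P₂ → v ∈ ps ⊎ Y v
      covers   : ∀ {v} → v ∈ ps → v ∈ P₁ ⊎ v ∈ P₂

  TwoPathsFor : ℕ → Set₁
  TwoPathsFor k = ∀ {Y ps E} → ZigzagFreePath Y ps → k ≤ length ps →
                  CommonNeighboursOr k Y ps E → TwoPaths k Y ps ⊎ E

  module Split (as : List V) (a : V) (B : List V) where

    pre : List V
    pre = as ∷ʳ a

    pre++B≡ : pre ++ B ≡ as ++ a ∷ B
    pre++B≡ = ∷ʳ-++ as a B

    pre⊆ : ∀ {v} → v ∈ pre → v ∈ as ++ a ∷ B
    pre⊆ v∈ = subst (_ ∈_) pre++B≡ (∈-++⁺ˡ v∈)

    B⊆ : ∀ {v} → v ∈ B → v ∈ as ++ a ∷ B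
    B⊆ v∈ = ∈-++⁺ʳ as (there v∈)

    length-split : length (as ++ a ∷ B) ≡ length pre + length B
    length-split = trans (cong length (sym pre++B≡)) (length-++ pre)

    IsPath-split : IsPath D (as ++ a ∷ B) → IsPath D pre × IsPath D B × Disjoint pre B
    IsPath-split p = IsPath-++⁻ pre (subst (IsPath D) (sym pre++B≡) p)

  module _ {Y : Pred V 0ℓ} {as : List V} {a b : V} {bs : List V} where

    open Split as a (b ∷ bs)

    ZigzagFreePath-prefix : ZigzagFreePath Y (as ++ a ∷ b ∷ bs) →
                            ZigzagFreePath (Y ∩ InNeighbourOf b) pre
    ZigzagFreePath-prefix F = record
      { isPath        = proj₁ (IsPath-split isPath)
      ; avoids        = λ (Yy , _) y∈ → avoids Yy (pre⊆ y∈)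
      ; noArcToHead   = λ (Yy , _) → NoArcToHead-++⁻ˡ pre
                          (subst (NoArcToHead _) (sym pre++B≡) (noArcToHead Yy))
      ; noArcFromLast = λ (Yy , yb) as′ x e xy → noZigzag Yy as a b bs refl
                          (subst (λ z → Arc D z _) (sym (∷ʳ-injectiveʳ as as′ e)) xy , yb)
      ; noZigzag      = λ (Yy , _) → NoZigzag-++⁻ˡ pre
                          (subst (NoZigzag _) (sym pre++B≡) (noZigzag Yy))
      }
      where open ZigzagFreePath F

    CommonNeighboursOr-prefix : ∀ {k E} → ZigzagFreePath Y (as ++ a ∷ b ∷ bs) →
      CommonNeighboursOr (suc k) Y (as ++ a ∷ b ∷ bs) E →
      CommonNeighboursOr k (Y ∩ InNeighbourOf b) pre (E ⊎ OutNeighbourIn Y b)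
    CommonNeighboursOr-prefix F common ss ss! |ss| ss⊆pre
      with common (b ∷ ss) (All.map b≢ ss⊆pre ∷ ss!) (cong suc |ss|)
                  (B⊆ (here refl) ∷ All.map pre⊆ ss⊆pre)
      where
      b≢ : ∀ {s} → s ∈ pre → b ≢ s
      b≢ s∈pre refl = proj₂ (proj₂ (IsPath-split (ZigzagFreePath.isPath F))) (s∈pre , here refl)
    ... | inj₂ ε                        = inj₂ (inj₁ ε)
    ... | inj₁ (y , Yy , inj₁ yb ∷ adj) = inj₁ (y , (Yy , yb) , adj)
    ... | inj₁ (y , Yy , inj₂ by ∷ _)   = inj₂ (inj₂ (y , Yy , by))

    -- y cannot be an in-neighbour of b, since a → y → b would be a zigzag.
    ∉-y∷suffix : ∀ {y v} → ZigzagFreePath Y (as ++ a ∷ b ∷ bs) → Y y → Arc D a y →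
                 v ∈ pre ⊎ (Y ∩ InNeighbourOf b) v → v ∉ y ∷ b ∷ bs
    ∉-y∷suffix F Yy _  (inj₁ v∈pre)    (here refl) = ZigzagFreePath.avoids F Yy (pre⊆ v∈pre)
    ∉-y∷suffix F _  _  (inj₁ v∈pre)    (there v∈B) =
      proj₂ (proj₂ (IsPath-split (ZigzagFreePath.isPath F))) (v∈pre , v∈B)
    ∉-y∷suffix F Yy ay (inj₂ (_ , yb)) (here refl) = ZigzagFreePath.noZigzag F Yy as a b bs refl (ay , yb)
    ∉-y∷suffix F _  _  (inj₂ (Yv , _)) (there v∈B) = ZigzagFreePath.avoids F Yv (B⊆ v∈B)

    TwoPaths-extend : ∀ {k y} → ZigzagFreePath Y (as ++ a ∷ b ∷ bs) → Y y → Arc D a y →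
                      TwoPaths k (Y ∩ InNeighbourOf b) pre → TwoPaths (suc k) Y (as ++ a ∷ b ∷ bs)
    TwoPaths-extend {k} {y} F Yy ay Q = record
      { P₁       = Q.P₂ ++ b ∷ bs
      ; P₂       = Q.P₁ ∷ʳ y
      ; isPath₁  = IsPath-join Q.P₂ Q.isPath₂ B-path
                     (λ (v∈Q₂ , v∈B) → fresh (Q.⊆₂ v∈Q₂) (there v∈B)) Q.last₂ (proj₂ Q.end∈Y)
      ; isPath₂  = IsPath-join Q.P₁ Q.isPath₁ ([] ∷ [] , [-])
                     (λ { (v∈Q₁ , here refl) → fresh (Q.⊆₁ v∈Q₁) (here refl) })
                     (trans Q.last₁ (last-++-∷ as a [])) ay
      ; disjoint = disjoint
      ; size     = size
      ; last₁    = trans (last-++-∷ Q.P₂ b bs) (sym (last-++-∷ as a (b ∷ bs)))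
      ; end      = y
      ; end∈Y    = Yy
      ; last₂    = last-++-∷ Q.P₁ y []
      ; ⊆₁       = λ v∈P₁ → [ lift ∘ Q.⊆₂ , inj₁ ∘ B⊆ ]′ (∈-++⁻ Q.P₂ v∈P₁)
      ; ⊆₂       = λ v∈P₂ → [ lift ∘ Q.⊆₁ , (λ { (here refl) → inj₂ Yy }) ]′ (∈-++⁻ Q.P₁ v∈P₂)
      ; covers   = covers
      }
      where
      module Q = TwoPaths Q
      open ZigzagFreePath F

      B-path : IsPath D (b ∷ bs)
      B-path = proj₁ (proj₂ (IsPath-split isPath))

      lift : ∀ {v} → v ∈ pre ⊎ (Y ∩ InNeighbourOf b) v → v ∈ as ++ a ∷ b ∷ bs ⊎ Y v
      lift = ⊎-map pre⊆ proj₁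

      fresh : ∀ {v} → v ∈ pre ⊎ (Y ∩ InNeighbourOf b) v → v ∉ y ∷ b ∷ bs
      fresh = ∉-y∷suffix F Yy ay

      disjoint : Disjoint (Q.P₂ ++ b ∷ bs) (Q.P₁ ∷ʳ y)
      disjoint (v∈P₁ , v∈P₂) with ∈-++⁻ Q.P₂ v∈P₁ | ∈-++⁻ Q.P₁ v∈P₂
      ... | inj₁ v∈Q₂ | inj₁ v∈Q₁        = Q.disjoint (v∈Q₁ , v∈Q₂)
      ... | inj₁ v∈Q₂ | inj₂ (here refl) = fresh (Q.⊆₂ v∈Q₂) (here refl)
      ... | inj₂ v∈B  | inj₁ v∈Q₁        = fresh (Q.⊆₁ v∈Q₁) (there v∈B)
      ... | inj₂ v∈B  | inj₂ (here refl) = avoids Yy (B⊆ v∈B)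

      covers : ∀ {v} → v ∈ as ++ a ∷ b ∷ bs → v ∈ Q.P₂ ++ b ∷ bs ⊎ v ∈ Q.P₁ ∷ʳ y
      covers v∈ with ∈-++⁻ pre (subst (_ ∈_) (sym pre++B≡) v∈)
      ... | inj₁ v∈pre = swap (⊎-map ∈-++⁺ˡ ∈-++⁺ˡ (Q.covers v∈pre))
      ... | inj₂ v∈B   = inj₁ (∈-++⁺ʳ Q.P₂ v∈B)

      size : length (Q.P₂ ++ b ∷ bs) + length (Q.P₁ ∷ʳ y) ≡ length (as ++ a ∷ b ∷ bs) + suc k + 1
      size = begin
        length (Q.P₂ ++ b ∷ bs) + length (Q.P₁ ∷ʳ y)
          ≡⟨ cong₂ _+_ (length-++ Q.P₂) (length-++ Q.P₁) ⟩
        (length Q.P₂ + length (b ∷ bs)) + (length Q.P₁ + 1)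
          ≡⟨ size-extend (length Q.P₁) (length Q.P₂) (length pre) (length (b ∷ bs)) k Q.size ⟩
        (length pre + length (b ∷ bs)) + suc k + 1
          ≡⟨ cong (λ m → m + suc k + 1) (sym length-split) ⟩
        length (as ++ a ∷ b ∷ bs) + suc k + 1  ∎
        where open ≡-Reasoning

  scan : ∀ {k Y E ps} → TwoPathsFor k → ZigzagFreePath Y ps → CommonNeighboursOr (suc k) Y ps E →
         ∀ as a B → ps ≡ as ++ a ∷ B → k ≤ length as →
         ∀ {y} → Y y → Arc D a y → TwoPaths (suc k) Y ps ⊎ E
  scan ih F _ as a [] refl _ Yy ay = ⊥-elim (ZigzagFreePath.noArcFromLast F Yy as a refl ay)
  scan ih F common as a (b ∷ bs) refl k≤|as| Yy ay
    with ih (ZigzagFreePath-prefix F) (≤-trans k≤|as| (length-≤-∷ʳ as a))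
            (CommonNeighboursOr-prefix F common)
  ... | inj₁ Q                    = inj₁ (TwoPaths-extend F Yy ay Q)
  ... | inj₂ (inj₁ ε)             = inj₂ ε
  ... | inj₂ (inj₂ (z , Yz , bz)) = scan ih F common (as ∷ʳ a) b bs (sym (∷ʳ-++ as a (b ∷ bs)))
                                      (≤-trans k≤|as| (length-≤-∷ʳ as a)) Yz bz

  arcInto-commonNeighbour : ∀ {Y y} as a B → ZigzagFreePath Y (as ++ a ∷ B) → Y y →
                            All (Adj D y) (as ∷ʳ a) → Arc D a y
  arcInto-commonNeighbour as a B F Yy adj = proj₂ (∷ʳ⁻ (adjacent⇒arcsInto pre
    (NoArcToHead-++⁻ˡ pre (subst (NoArcToHead _) (sym pre++B≡) (noArcToHead Yy)))
    (NoZigzag-++⁻ˡ pre (subst (NoZigzag _) (sym pre++B≡) (noZigzag Yy)))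
    adj))
    where
    open Split as a B
    open ZigzagFreePath F

  twoPaths-zero : TwoPathsFor 0
  twoPaths-zero {ps = ps} F _ common with common [] [] refl []
  ... | inj₂ ε             = inj₂ ε
  ... | inj₁ (y , Yy , []) = inj₁ record
    { P₁       = ps
    ; P₂       = [ y ]
    ; isPath₁  = isPath
    ; isPath₂  = [] ∷ [] , [-]
    ; disjoint = λ { (y∈ps , here refl) → avoids Yy y∈ps }
    ; size     = cong (_+ 1) (sym (+-identityʳ (length ps)))
    ; last₁    = refl
    ; end      = y
    ; end∈Y    = Yy
    ; last₂    = refl
    ; ⊆₁       = inj₁
    ; ⊆₂       = λ { (here refl) → inj₂ Yy }
    ; covers   = inj₁
    }
    where open ZigzagFreePath F

  twoPaths-suc : ∀ {k} → TwoPathsFor k → TwoPathsFor (suc k)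
  twoPaths-suc ih {ps = ps} F k<|ps| common with ∃-split-at _ ps k<|ps|
  ... | as , a , B , refl , refl
    with common (as ∷ʳ a) (proj₁ (proj₁ (Split.IsPath-split as a B (ZigzagFreePath.isPath F))))
                (trans (length-++ as) (+-comm (length as) 1)) (All.tabulate (Split.pre⊆ as a B))
  ... | inj₂ ε              = inj₂ ε
  ... | inj₁ (y , Yy , adj) = scan ih F common as a B refl ≤-refl Yy (arcInto-commonNeighbour as a B F Yy adj)

  twoPaths : ∀ k → TwoPathsFor k
  twoPaths zero    = twoPaths-zero
  twoPaths (suc k) = twoPaths-suc (twoPaths k)

lemma6 : (k : ℕ) → k > 0 → (D : Digraph) → (X : Subset (n D)) →
    Traceable D X → StableCompl D X → ∣ X ∣ ≥ k →
    (∀ (S : Subset (n D)) → S ⊆ X → ∣ S ∣ ≡ k →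
      ∃[ y ] (y ∉ₛ X × (∀ s → s ∈ₛ S → Adj D y s))) →
    (xs : List (Vtx D)) → (xℓ : Vtx D) →
    HamPathOf D X (xs ++ [ xℓ ]) → ZigzagFree D X (xs ++ [ xℓ ]) →
    ∃[ P₁ ] ∃[ P₂ ] (IsPath D P₁ × IsPath D P₂
      × (∀ v → v ∈ P₁ → v ∉ P₂)
      × length P₁ + length P₂ ≡ ∣ X ∣ + k + 1
      × (∃[ y ] (y ∉ₛ X × ((last P₁ ≡ just xℓ × last P₂ ≡ just y) ⊎ (last P₁ ≡ just y × last P₂ ≡ just xℓ))))
      × (∀ v → v ∈ₛ X → v ∈ P₁ ⊎ v ∈ P₂))
lemma6 k _ D X _ _ k≤∣X∣ common xs xℓ (path , ps⊆X , X⊆ps) zigzagFree =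
  P₁ , P₂ , isPath₁ , isPath₂ , (λ _ v∈P₁ v∈P₂ → disjoint (v∈P₁ , v∈P₂)) ,
  trans size (cong (λ m → m + k + 1) (sym ∣X∣≡∣ps∣)) ,
  (end , end∈Y , inj₁ (trans last₁ (last-++-∷ xs xℓ []) , last₂)) ,
  λ v v∈X → covers (X⊆ps v v∈X)
  where
  ps : List (Vtx D)
  ps = xs ∷ʳ xℓ

  ∣X∣≡∣ps∣ : ∣ X ∣ ≡ length ps
  ∣X∣≡∣ps∣ = ∣p∣≡length (proj₁ path) (X⊆ps _) (ps⊆X _)

  F : ZigzagFreePath D (_∉ₛ X) ps
  F = record
    { isPath        = path
    ; avoids        = λ y∉X y∈ps → y∉X (ps⊆X _ y∈ps)
    ; noArcToHead   = λ y∉X → proj₁ (zigzagFree _ y∉X)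
    ; noArcFromLast = λ y∉X → proj₁ (proj₂ (zigzagFree _ y∉X))
    ; noZigzag      = λ y∉X → proj₂ (proj₂ (zigzagFree _ y∉X))
    }

  common′ : CommonNeighboursOr D k (_∉ₛ X) ps ⊥
  common′ ss ss! |ss|≡k ss⊆ps with common (fromList ss)
    (λ v∈ → ps⊆X _ (All.lookup ss⊆ps (∈-fromList⁻ ss v∈))) (trans (∣fromList∣≡length ss!) |ss|≡k)
  ... | y , y∉X , adj = inj₁ (y , y∉X , All.tabulate (λ s∈ → adj _ (∈-fromList⁺ s∈)))

  open TwoPaths (fromInj₁ ⊥-elim (twoPaths D k F (subst (k ≤_) ∣X∣≡∣ps∣ k≤∣X∣) common′))
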